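{- Let $T$ be a semi-complete digraph. Then every outdegree ordering of $V(T)$ has width at most $m(\mathbf{ctw}(T))$, where $m(t)=100t^2+22t+1$.
   Context: All digraphs are simple (no loops, no multiple arcs). A digraph $T$ is semi-complete if for every two distinct vertices $v,w$ at least one of the arcs $(v,w)$, $(w,v)$ is present (both may be present). $d^+(v)$ denotes the outdegree of $v$. An outdegree ordering of $V(T)$ is an ordering of the vertices by nondecreasing outdegree. For an ordering $\pi$ of $V=V(T)$, let $\pi[\alpha]$ be the set of the first $\alpha$ vertices; for $X,Y\subseteq V$, $E(X,Y)$ is the set of arcs $(x,y)$ with $x\in X$, $y\in Y$. The width of $\pi$ is $\max_{0\le\alpha\le|V|}|E(\pi[\alpha],V\setminus\pi[\alpha])|$, and the cutwidth $\mathbf{ctw}(T)$ is the minimum width over all orderings of $V$. -}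

module Defs where

open import Data.Nat using (ℕ; zero; suc; _+_; _*_; _≤_; _<ᵇ_; _⊔_)
open import Data.Bool using (Bool; true; false; _∧_; not; if_then_else_)
open import Data.Fin using (Fin; toℕ)
import Data.Fin as F
open import Data.List using (List; map; foldr; upTo)
open import Data.Sum using (_⊎_)
open import Data.Product using (Σ; _×_)
open import Relation.Binary.PropositionalEquality using (_≡_; _≢_)
open import Data.Fin.Permutation using (Permutation′; _⟨$⟩ʳ_)

record Digraph (n : ℕ) : Set where
  field
    arc : Fin n → Fin n → Bool
    loopless : ∀ v → arc v v ≡ false

open Digraph public

SemiComplete : ∀ {n} → Digraph n → Set
SemiComplete {n} T = ∀ (v w : Fin n) → v ≢ w → (arc T v w ≡ true) ⊎ (arc T w v ≡ true)

count : ∀ n → (Fin n → Bool) → ℕ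
count zero p = 0
count (suc n) p = (if p F.zero then 1 else 0) + count n (λ i → p (F.suc i))

outdeg : ∀ {n} → Digraph n → Fin n → ℕ
outdeg {n} T v = count n (arc T v)

-- An ordering of V(T): π maps positions (Fin n) to vertices, bijectively.
Ordering : ℕ → Set
Ordering n = Permutation′ n

IsOutdegreeOrdering : ∀ {n} → Digraph n → Ordering n → Set
IsOutdegreeOrdering {n} T π =
  ∀ (i j : Fin n) → toℕ i ≤ toℕ j → outdeg T (π ⟨$⟩ʳ i) ≤ outdeg T (π ⟨$⟩ʳ j)

sumF : ∀ n → (Fin n → ℕ) → ℕ
sumF zero f = 0
sumF (suc n) f = f F.zero + sumF n (λ i → f (F.suc i))

cutSize : ∀ {n} → Digraph n → Ordering n → ℕ → ℕ
cutSize {n} T π α =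
  sumF n (λ i → count n (λ j →
    (toℕ i <ᵇ α) ∧ not (toℕ j <ᵇ α) ∧ arc T (π ⟨$⟩ʳ i) (π ⟨$⟩ʳ j)))

width : ∀ {n} → Digraph n → Ordering n → ℕ
width {n} T π = foldr _⊔_ 0 (map (cutSize T π) (upTo (suc n)))

IsCutwidth : ∀ {n} → Digraph n → ℕ → Set
IsCutwidth {n} T k = Σ (Ordering n) (λ σ → width T σ ≡ k) × (∀ (σ : Ordering n) → k ≤ width T σ)

m : ℕ → ℕ
m t = 100 * t * t + 22 * t + 1

module Submission where

-- In fact we prove the sharper bound 2k + (2k+1)² ≤ m k, where
-- k is the width of ANY ordering σ of T.
--
-- In any ordering σ of a semi-complete digraph, the position
--    of every vertex v differs from its outdegree by at most k = width σ:
--    each earlier vertex u is an out-neighbour of v or sends an arc across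
--    the cut in front of v, and each later out-neighbour of v receives an arc
--    across the cut just behind v.
-- 2. Thresholds.  In an outdegree ordering π, every cut has a threshold D:
--    vertices before it have outdegree ≤ D and vertices after it ≥ D.
-- 3. Cut bound.  By 1 and 2, an arc crossing such a cut of π has its tail at
--    σ-position ≤ D + k and its head at σ-position ≥ D − k.  So it crosses the
--    σ-cut at L = D ∸ k, or the σ-cut at L + 2k + 1, or both of its ends lie
--    in the window [L, L + 2k + 1) of 2k + 1 positions: at most k + k + (2k+1)²
--    arcs in total.

open import Defs
open import Data.Nat using (ℕ; zero; suc; _+_; _*_; _∸_; _≤_; _<_; _<ᵇ_; _⊔_; z≤n; s≤s; s≤s⁻¹; _<?_)
open import Data.Nat.Properties
open import Data.Nat.Solver using (module +-*-Solver)
open import Data.Bool using (Bool; true; false; _∧_; not; if_then_else_)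
open import Data.Fin using (Fin; toℕ; fromℕ<)
import Data.Fin as F
open import Data.Fin.Properties using (toℕ-injective; toℕ<n; toℕ-fromℕ<)
open import Data.Fin.Permutation using (Permutation′; _⟨$⟩ʳ_; _⟨$⟩ˡ_; inverseˡ; inverseʳ)
open import Data.List using ([]; _∷_; map; foldr; upTo)
open import Data.List.Relation.Unary.Any using (here; there)
open import Data.List.Membership.Propositional using (_∈_)
open import Data.List.Membership.Propositional.Properties using (∈-upTo⁺)
open import Data.Product using (Σ; _×_; _,_)
open import Data.Sum using (inj₁; inj₂)
open import Data.Empty using (⊥-elim)
open import Relation.Nullary using (yes; no; ¬_)
open import Relation.Nullary.Reflects using (ofʸ; ofⁿ)
open import Relation.Binary.PropositionalEquality
import Algebra.Properties.CommutativeMonoid.Sum as MonoidSum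

⟦_⟧ : Bool → ℕ
⟦ b ⟧ = if b then 1 else 0

⟦⟧≤1 : ∀ b → ⟦ b ⟧ ≤ 1
⟦⟧≤1 true = ≤-refl
⟦⟧≤1 false = z≤n

count≡sumF : ∀ n (p : Fin n → Bool) → count n p ≡ sumF n (λ i → ⟦ p i ⟧)
count≡sumF zero p = refl
count≡sumF (suc n) p = cong (⟦ p F.zero ⟧ +_) (count≡sumF n (λ i → p (F.suc i)))

count≤n : ∀ n (p : Fin n → Bool) → count n p ≤ n
count≤n zero p = z≤n
count≤n (suc n) p = +-mono-≤ (⟦⟧≤1 (p F.zero)) (count≤n n (λ i → p (F.suc i)))

sumF-cong : ∀ n {f g : Fin n → ℕ} → (∀ i → f i ≡ g i) → sumF n f ≡ sumF n g
sumF-cong zero h = refl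
sumF-cong (suc n) h = cong₂ _+_ (h F.zero) (sumF-cong n (λ i → h (F.suc i)))

sumF-mono : ∀ n {f g : Fin n → ℕ} → (∀ i → f i ≤ g i) → sumF n f ≤ sumF n g
sumF-mono zero h = z≤n
sumF-mono (suc n) h = +-mono-≤ (h F.zero) (sumF-mono n (λ i → h (F.suc i)))

sumF-zero : ∀ n → sumF n (λ _ → 0) ≡ 0
sumF-zero zero = refl
sumF-zero (suc n) = sumF-zero n

sumF-+ : ∀ n (f g : Fin n → ℕ) → sumF n (λ i → f i + g i) ≡ sumF n f + sumF n g
sumF-+ zero f g = refl
sumF-+ (suc n) f g = begin
  (f F.zero + g F.zero) + sumF n (λ i → f (F.suc i) + g (F.suc i))
    ≡⟨ cong ((f F.zero + g F.zero) +_) (sumF-+ n (λ i → f (F.suc i)) (λ i → g (F.suc i))) ⟩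
  (f F.zero + g F.zero) + (sumF n (λ i → f (F.suc i)) + sumF n (λ i → g (F.suc i)))
    ≡⟨ interchange (f F.zero) (g F.zero) _ _ ⟩
  (f F.zero + sumF n (λ i → f (F.suc i))) + (g F.zero + sumF n (λ i → g (F.suc i))) ∎
  where
  open ≡-Reasoning
  open import Algebra.Properties.CommutativeSemigroup +-commutativeSemigroup using (interchange)

sumF-*ˡ : ∀ n c (f : Fin n → ℕ) → sumF n (λ i → c * f i) ≡ c * sumF n f
sumF-*ˡ zero c f = sym (*-zeroʳ c)
sumF-*ˡ (suc n) c f =
  trans (cong (c * f F.zero +_) (sumF-*ˡ n c (λ i → f (F.suc i))))
        (sym (*-distribˡ-+ c (f F.zero) _))

term≤sumF : ∀ n (f : Fin n → ℕ) i → f i ≤ sumF n f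
term≤sumF (suc n) f F.zero = m≤m+n _ _
term≤sumF (suc n) f (F.suc i) = ≤-trans (term≤sumF n (λ j → f (F.suc j)) i) (m≤n+m _ _)

sumF-permute : ∀ n (f : Fin n → ℕ) (ρ : Permutation′ n) → sumF n f ≡ sumF n (λ i → f (ρ ⟨$⟩ʳ i))
sumF-permute n f ρ = trans (sumF≡sum n f) (trans (sum-permute f ρ) (sym (sumF≡sum n _)))
  where
  open MonoidSum +-0-commutativeMonoid using (sum; sum-permute)
  sumF≡sum : ∀ n (g : Fin n → ℕ) → sumF n g ≡ sum g
  sumF≡sum zero g = refl
  sumF≡sum (suc n) g = cong (g F.zero +_) (sumF≡sum n (λ i → g (F.suc i)))

sumF² : ∀ n → (Fin n → Fin n → ℕ) → ℕ
sumF² n f = sumF n (λ x → sumF n (λ y → f x y))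

sumF²-mono : ∀ n {f g : Fin n → Fin n → ℕ} → (∀ x y → f x y ≤ g x y) → sumF² n f ≤ sumF² n g
sumF²-mono n h = sumF-mono n (λ x → sumF-mono n (h x))

sumF²-+ : ∀ n (f g : Fin n → Fin n → ℕ) → sumF² n (λ x y → f x y + g x y) ≡ sumF² n f + sumF² n g
sumF²-+ n f g = trans (sumF-cong n (λ x → sumF-+ n (f x) (g x))) (sumF-+ n _ _)

sumF²-product : ∀ n (f : Fin n → ℕ) → sumF² n (λ x y → f x * f y) ≡ sumF n f * sumF n f
sumF²-product n f = begin
  sumF n (λ x → sumF n (λ y → f x * f y)) ≡⟨ sumF-cong n (λ x → sumF-*ˡ n (f x) f) ⟩
  sumF n (λ x → f x * sumF n f)          ≡⟨ sumF-cong n (λ x → *-comm (f x) _) ⟩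
  sumF n (λ x → sumF n f * f x)          ≡⟨ sumF-*ˡ n (sumF n f) f ⟩
  sumF n f * sumF n f ∎
  where open ≡-Reasoning

prefix-count : ∀ n c → c ≤ n → sumF n (λ i → ⟦ toℕ i <ᵇ c ⟧) ≡ c
prefix-count n zero _ = sumF-zero n
prefix-count (suc n) (suc c) (s≤s c≤n) = cong suc (prefix-count n c c≤n)

inWindow : ℕ → ℕ → ℕ → Bool
inWindow L len z = not (z <ᵇ L) ∧ (z <ᵇ L + len)

window-count : ∀ n L len → sumF n (λ i → ⟦ inWindow L len (toℕ i) ⟧) ≤ len
window-count zero L len = z≤n
window-count (suc n) (suc L) len = window-count n L len
window-count (suc n) zero zero = ≤-reflexive (sumF-zero n)
window-count (suc n) zero (suc len) = s≤s (window-count n zero len)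

n<ᵇ1+n : ∀ k → (k <ᵇ suc k) ≡ true
n<ᵇ1+n zero = refl
n<ᵇ1+n (suc k) = n<ᵇ1+n k

<⇒<ᵇ≡true : ∀ {a b} → a < b → (a <ᵇ b) ≡ true
<⇒<ᵇ≡true {a} {b} a<b with a <ᵇ b | <ᵇ-reflects-< a b
... | true | _ = refl
... | false | ofⁿ a≮b = ⊥-elim (a≮b a<b)

≥⇒<ᵇ≡false : ∀ {a b} → b ≤ a → (a <ᵇ b) ≡ false
≥⇒<ᵇ≡false {a} {b} b≤a with a <ᵇ b | <ᵇ-reflects-< a b
... | false | _ = refl
... | true | ofʸ a<b = ⊥-elim (<-irrefl refl (<-≤-trans a<b b≤a))

foldr-⊔-ub : ∀ (f : ℕ → ℕ) {x} xs → x ∈ xs → f x ≤ foldr _⊔_ 0 (map f xs)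
foldr-⊔-ub f (y ∷ xs) (here refl) = m≤m⊔n (f y) _
foldr-⊔-ub f (y ∷ xs) (there x∈xs) = m≤n⇒m≤o⊔n (f y) (foldr-⊔-ub f xs x∈xs)

foldr-⊔-lub : ∀ (f : ℕ → ℕ) B xs → (∀ x → f x ≤ B) → foldr _⊔_ 0 (map f xs) ≤ B
foldr-⊔-lub f B [] h = z≤n
foldr-⊔-lub f B (x ∷ xs) h = ⊔-lub (h x) (foldr-⊔-lub f B xs h)

cutSize-beyond : ∀ {n} (T : Digraph n) ρ α → n ≤ α → cutSize T ρ α ≡ 0
cutSize-beyond {n} T ρ α n≤α =
  trans (sumF-cong n (λ i → trans (count≡sumF n _) (trans (sumF-cong n (empty i)) (sumF-zero n))))
        (sumF-zero n)
  where
  empty : ∀ i j → ⟦ (toℕ i <ᵇ α) ∧ not (toℕ j <ᵇ α) ∧ arc T (ρ ⟨$⟩ʳ i) (ρ ⟨$⟩ʳ j) ⟧ ≡ 0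
  empty i j rewrite <⇒<ᵇ≡true (<-≤-trans (toℕ<n j) n≤α) with toℕ i <ᵇ α
  ... | true = refl
  ... | false = refl

cut≤width : ∀ {n} (T : Digraph n) ρ α → cutSize T ρ α ≤ width T ρ
cut≤width {n} T ρ α with α <? suc n
... | yes α≤n = foldr-⊔-ub (cutSize T ρ) (upTo (suc n)) (∈-upTo⁺ α≤n)
... | no α≰n = subst (_≤ width T ρ) (sym (cutSize-beyond T ρ α (<⇒≤ (≮⇒≥ α≰n)))) z≤n

width-lub : ∀ {n} (T : Digraph n) ρ B → (∀ α → cutSize T ρ α ≤ B) → width T ρ ≤ B
width-lub {n} T ρ B = foldr-⊔-lub (cutSize T ρ) B (upTo (suc n))

pos : ∀ {n} → Ordering n → Fin n → ℕ
pos ρ v = toℕ (ρ ⟨$⟩ˡ v)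

pos-injective : ∀ {n} (ρ : Ordering n) {u v} → pos ρ u ≡ pos ρ v → u ≡ v
pos-injective ρ {u} {v} eq =
  trans (sym (inverseʳ ρ)) (trans (cong (ρ ⟨$⟩ʳ_) (toℕ-injective eq)) (inverseʳ ρ))

sumF-positions : ∀ {n} (ρ : Ordering n) (g : ℕ → ℕ) → sumF n (λ v → g (pos ρ v)) ≡ sumF n (λ i → g (toℕ i))
sumF-positions {n} ρ g =
  trans (sumF-permute n _ ρ) (sumF-cong n (λ i → cong (λ j → g (toℕ j)) (inverseˡ ρ)))

crossing : ∀ {n} → Digraph n → Ordering n → ℕ → Fin n → Fin n → ℕ
crossing T ρ α x y = ⟦ (pos ρ x <ᵇ α) ∧ not (pos ρ y <ᵇ α) ∧ arc T x y ⟧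

cutSize-by-vertices : ∀ {n} (T : Digraph n) ρ α → cutSize T ρ α ≡ sumF² n (crossing T ρ α)
cutSize-by-vertices {n} T ρ α = begin
  cutSize T ρ α
    ≡⟨ sumF-cong n (λ i → trans (count≡sumF n _) (sumF-cong n (λ j → cong ⟦_⟧ (positions i j)))) ⟩
  sumF² n (λ i j → crossing T ρ α (ρ ⟨$⟩ʳ i) (ρ ⟨$⟩ʳ j))
    ≡⟨ sym (sumF-permute n _ ρ) ⟩
  sumF n (λ x → sumF n (λ j → crossing T ρ α x (ρ ⟨$⟩ʳ j)))
    ≡⟨ sumF-cong n (λ x → sym (sumF-permute n _ ρ)) ⟩
  sumF² n (crossing T ρ α) ∎
  where
  open ≡-Reasoning
  positions : ∀ i j → (toℕ i <ᵇ α) ∧ not (toℕ j <ᵇ α) ∧ arc T (ρ ⟨$⟩ʳ i) (ρ ⟨$⟩ʳ j)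
                    ≡ (pos ρ (ρ ⟨$⟩ʳ i) <ᵇ α) ∧ not (pos ρ (ρ ⟨$⟩ʳ j) <ᵇ α) ∧ arc T (ρ ⟨$⟩ʳ i) (ρ ⟨$⟩ʳ j)
  positions i j rewrite inverseˡ ρ {i} | inverseˡ ρ {j} = refl

crossings≤width : ∀ {n} (T : Digraph n) ρ α → sumF² n (crossing T ρ α) ≤ width T ρ
crossings≤width T ρ α = ≤-trans (≤-reflexive (sym (cutSize-by-vertices T ρ α))) (cut≤width T ρ α)

row≤width : ∀ {n} (T : Digraph n) ρ α v → sumF n (crossing T ρ α v) ≤ width T ρ
row≤width {n} T ρ α v =
  ≤-trans (term≤sumF n (λ x → sumF n (crossing T ρ α x)) v) (crossings≤width T ρ α)

column≤width : ∀ {n} (T : Digraph n) ρ α v → sumF n (λ u → crossing T ρ α u v) ≤ width T ρ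
column≤width {n} T ρ α v =
  ≤-trans (sumF-mono n (λ u → term≤sumF n (crossing T ρ α u) v)) (crossings≤width T ρ α)

outdeg≡sumF : ∀ {n} (T : Digraph n) v → outdeg T v ≡ sumF n (λ u → ⟦ arc T v u ⟧)
outdeg≡sumF {n} T v = count≡sumF n (arc T v)

predecessors-count : ∀ {n} (σ : Ordering n) v → sumF n (λ u → ⟦ pos σ u <ᵇ pos σ v ⟧) ≡ pos σ v
predecessors-count {n} σ v =
  trans (sumF-positions σ (λ z → ⟦ z <ᵇ pos σ v ⟧)) (prefix-count n (pos σ v) (<⇒≤ (toℕ<n _)))

-- Proximity, upper half (any digraph): an out-neighbour u of v is either
-- before v, or strictly after v and then arc (v , u) leaves the first
-- pos v + 1 vertices.
outdeg≤pos+width : ∀ {n} (T : Digraph n) (σ : Ordering n) v → outdeg T v ≤ pos σ v + width T σ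
outdeg≤pos+width {n} T σ v = begin
  outdeg T v
    ≡⟨ outdeg≡sumF T v ⟩
  sumF n (λ u → ⟦ arc T v u ⟧)
    ≤⟨ sumF-mono n out-neighbour-earlier-or-crossing ⟩
  sumF n (λ u → ⟦ pos σ u <ᵇ pos σ v ⟧ + crossing T σ (suc (pos σ v)) v u)
    ≡⟨ sumF-+ n _ _ ⟩
  sumF n (λ u → ⟦ pos σ u <ᵇ pos σ v ⟧) + sumF n (crossing T σ (suc (pos σ v)) v)
    ≤⟨ +-mono-≤ (≤-reflexive (predecessors-count σ v)) (row≤width T σ (suc (pos σ v)) v) ⟩
  pos σ v + width T σ ∎
  where
  open ≤-Reasoning
  same-position : ∀ {u} → ¬ pos σ u < pos σ v → pos σ u < suc (pos σ v) → u ≡ v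
  same-position u≮v u<1+v = pos-injective σ (≤-antisym (s≤s⁻¹ u<1+v) (≮⇒≥ u≮v))
  out-neighbour-earlier-or-crossing :
    ∀ u → ⟦ arc T v u ⟧ ≤ ⟦ pos σ u <ᵇ pos σ v ⟧ + crossing T σ (suc (pos σ v)) v u
  out-neighbour-earlier-or-crossing u with arc T v u in vu
  ... | false = z≤n
  ... | true with pos σ u <ᵇ pos σ v | <ᵇ-reflects-< (pos σ u) (pos σ v)
  ... | true | _ = s≤s z≤n
  ... | false | ofⁿ u≮v rewrite n<ᵇ1+n (pos σ v)
        with pos σ u <ᵇ suc (pos σ v) | <ᵇ-reflects-< (pos σ u) (suc (pos σ v))
  ... | false | _ = s≤s z≤n
  ... | true | ofʸ u<1+v
        with () ← trans (sym vu) (trans (cong (arc T v) (same-position u≮v u<1+v)) (loopless T v))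

-- Proximity, lower half (semi-complete digraphs): a vertex u before v is an
-- out-neighbour of v, or arc (u , v) leaves the first pos v vertices.
pos≤outdeg+width : ∀ {n} (T : Digraph n) → SemiComplete T →
  (σ : Ordering n) → ∀ v → pos σ v ≤ outdeg T v + width T σ
pos≤outdeg+width {n} T sc σ v = begin
  pos σ v
    ≡⟨ sym (predecessors-count σ v) ⟩
  sumF n (λ u → ⟦ pos σ u <ᵇ pos σ v ⟧)
    ≤⟨ sumF-mono n earlier-out-neighbour-or-crossing ⟩
  sumF n (λ u → ⟦ arc T v u ⟧ + crossing T σ (pos σ v) u v)
    ≡⟨ sumF-+ n _ _ ⟩
  sumF n (λ u → ⟦ arc T v u ⟧) + sumF n (λ u → crossing T σ (pos σ v) u v)
    ≤⟨ +-mono-≤ (≤-reflexive (sym (outdeg≡sumF T v))) (column≤width T σ (pos σ v) v) ⟩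
  outdeg T v + width T σ ∎
  where
  open ≤-Reasoning
  p<ᵇp≡false : (pos σ v <ᵇ pos σ v) ≡ false
  p<ᵇp≡false = ≥⇒<ᵇ≡false {pos σ v} ≤-refl
  earlier-out-neighbour-or-crossing :
    ∀ u → ⟦ pos σ u <ᵇ pos σ v ⟧ ≤ ⟦ arc T v u ⟧ + crossing T σ (pos σ v) u v
  earlier-out-neighbour-or-crossing u with pos σ u <ᵇ pos σ v | <ᵇ-reflects-< (pos σ u) (pos σ v)
  ... | false | _ = z≤n
  ... | true | ofʸ u<v with sc v u (λ v≡u → <-irrefl (cong (pos σ) (sym v≡u)) u<v)
  ... | inj₁ vu rewrite vu = s≤s z≤n
  ... | inj₂ uv rewrite uv | p<ᵇp≡false = m≤n+m 1 _

arc-split : ∀ (e : Bool) X Y L len → X < L + len → L ≤ Y →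
  ⟦ e ⟧ ≤ (⟦ (X <ᵇ L) ∧ not (Y <ᵇ L) ∧ e ⟧ + ⟦ (X <ᵇ L + len) ∧ not (Y <ᵇ L + len) ∧ e ⟧)
          + ⟦ inWindow L len X ⟧ * ⟦ inWindow L len Y ⟧
arc-split false X Y L len _ _ = z≤n
arc-split true X Y L len X<U L≤Y rewrite ≥⇒<ᵇ≡false L≤Y | <⇒<ᵇ≡true X<U with X <ᵇ L
... | true = s≤s z≤n
... | false with Y <ᵇ L + len
...   | false = s≤s z≤n
...   | true = s≤s z≤n

cut-bound : ∀ {n} (T : Digraph n) → SemiComplete T → (σ π : Ordering n) → ∀ α D →
  (∀ x → pos π x < α → outdeg T x ≤ D) → (∀ y → α ≤ pos π y → D ≤ outdeg T y) →
  cutSize T π α ≤ (width T σ + width T σ) + suc (width T σ + width T σ) * suc (width T σ + width T σ)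
cut-bound {n} T sc σ π α D before after = begin
  cutSize T π α
    ≡⟨ cutSize-by-vertices T π α ⟩
  sumF² n (crossing T π α)
    ≤⟨ sumF²-mono n located ⟩
  sumF² n (λ x y → (crossing T σ L x y + crossing T σ (L + len) x y) + window x * window y)
    ≡⟨ trans (sumF²-+ n _ _) (cong₂ _+_ (sumF²-+ n _ _) (sumF²-product n window)) ⟩
  (sumF² n (crossing T σ L) + sumF² n (crossing T σ (L + len))) + sumF n window * sumF n window
    ≤⟨ +-mono-≤ (+-mono-≤ (crossings≤width T σ L) (crossings≤width T σ (L + len)))
                (*-mono-≤ window-size window-size) ⟩
  (k + k) + len * len ∎
  where
  open ≤-Reasoning
  k = width T σ
  L = D ∸ k
  len = suc (k + k)
  window : Fin n → ℕ
  window x = ⟦ inWindow L len (pos σ x) ⟧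
  window-size : sumF n window ≤ len
  window-size = ≤-trans (≤-reflexive (sumF-positions σ (λ z → ⟦ inWindow L len z ⟧))) (window-count n L len)
  tail-position : ∀ x → pos π x < α → pos σ x < L + len
  tail-position x x<α = ≤-trans (s≤s (begin
    pos σ x          ≤⟨ pos≤outdeg+width T sc σ x ⟩
    outdeg T x + k   ≤⟨ +-monoˡ-≤ k (before x x<α) ⟩
    D + k            ≤⟨ +-monoˡ-≤ k (≤-trans (m≤n+m∸n D k) (≤-reflexive (+-comm k L))) ⟩
    (L + k) + k      ≡⟨ +-assoc L k k ⟩
    L + (k + k)      ∎)) (≤-reflexive (sym (+-suc L (k + k))))
  head-position : ∀ y → α ≤ pos π y → L ≤ pos σ y
  head-position y α≤y = m≤n+o⇒m∸n≤o D k (begin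
    D                ≤⟨ after y α≤y ⟩
    outdeg T y       ≤⟨ outdeg≤pos+width T σ y ⟩
    pos σ y + k      ≡⟨ +-comm (pos σ y) k ⟩
    k + pos σ y      ∎)
  located : ∀ x y → crossing T π α x y ≤
    (crossing T σ L x y + crossing T σ (L + len) x y) + window x * window y
  located x y with pos π x <ᵇ α | <ᵇ-reflects-< (pos π x) α | pos π y <ᵇ α | <ᵇ-reflects-< (pos π y) α
  ... | false | _ | _ | _ = z≤n
  ... | true | _ | true | _ = z≤n
  ... | true | ofʸ x<α | false | ofⁿ y≮α =
    arc-split (arc T x y) (pos σ x) (pos σ y) L len (tail-position x x<α) (head-position y (≮⇒≥ y≮α))

quadratic-bound : ∀ k → (k + k) + suc (k + k) * suc (k + k) ≤ m k
quadratic-bound k = begin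
  (k + k) + suc (k + k) * suc (k + k) ≡⟨ expand k ⟩
  4 * k * k + 6 * k + 1               ≤⟨ +-monoˡ-≤ 1 (+-mono-≤ (*-monoˡ-≤ k (*-monoˡ-≤ k (m≤m+n 4 96)))
                                                             (*-monoˡ-≤ k (m≤m+n 6 16))) ⟩
  m k ∎
  where
  open ≤-Reasoning
  open +-*-Solver
  expand : ∀ k → (k + k) + suc (k + k) * suc (k + k) ≡ 4 * k * k + 6 * k + 1
  expand = solve 1 (λ k → (k :+ k) :+ (con 1 :+ (k :+ k)) :* (con 1 :+ (k :+ k))
                          := con 4 :* k :* k :+ con 6 :* k :+ con 1) refl

-- Every cut of an outdegree ordering has a threshold outdegree: the
-- outdegree of the first vertex behind the cut, or n if there is none.
threshold : ∀ {n} (T : Digraph n) (π : Ordering n) → IsOutdegreeOrdering T π → ∀ α →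
  Σ ℕ λ D → (∀ x → pos π x < α → outdeg T x ≤ D) × (∀ y → α ≤ pos π y → D ≤ outdeg T y)
threshold {n} T π ordered α with α <? n
... | yes α<n = outdeg T v₀ , (λ x x<α → monotone (≤-trans (<⇒≤ x<α) (≤-reflexive (sym pos-v₀))))
                            , (λ y α≤y → monotone (≤-trans (≤-reflexive pos-v₀) α≤y))
  where
  v₀ = π ⟨$⟩ʳ fromℕ< α<n
  pos-v₀ : pos π v₀ ≡ α
  pos-v₀ = trans (cong toℕ (inverseˡ π)) (toℕ-fromℕ< α<n)
  monotone : ∀ {x y} → pos π x ≤ pos π y → outdeg T x ≤ outdeg T y
  monotone {x} {y} le = subst₂ (λ u w → outdeg T u ≤ outdeg T w) (inverseʳ π) (inverseʳ π)
                               (ordered (π ⟨$⟩ˡ x) (π ⟨$⟩ˡ y) le)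
... | no α≮n = n , (λ x _ → count≤n n (arc T x))
                 , (λ y α≤y → ⊥-elim (α≮n (≤-<-trans α≤y (toℕ<n (π ⟨$⟩ˡ y)))))

theorem18 : ∀ (n : ℕ) (T : Digraph n) → SemiComplete T →
    ∀ (k : ℕ) → IsCutwidth T k →
    ∀ (π : Ordering n) → IsOutdegreeOrdering T π → width T π ≤ m k
theorem18 n T sc k ((σ , width-σ≡k) , _) π ordered =
  subst (λ t → width T π ≤ m t) width-σ≡k (width-lub T π (m (width T σ)) cut-bounded)
  where
  cut-bounded : ∀ α → cutSize T π α ≤ m (width T σ)
  cut-bounded α with threshold T π ordered α
  ... | D , before , after = ≤-trans (cut-bound T sc σ π α D before after) (quadratic-bound (width T σ))
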